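{- Let $p_1<p_2<\dots<p_k$ be distinct primes, $n=p_1\cdots p_k$, and $M_k=\prod_{i=1}^{k-2}p_i^{2^{k-i-1}-1}$. Then $$M_k\le \varphi(n)^{2^{k-1}/k-1},$$ where $\varphi$ is Euler's totient function. -}

module Defs where

open import Data.Nat using (ℕ; zero; suc; _*_; _^_; _∸_; _<ᵇ_)
open import Data.Nat.Coprimality using (coprime?)
open import Data.Fin using (Fin; toℕ) renaming (zero to fzero; suc to fsuc)
open import Data.List using (List; length; filter; map; upTo)
open import Data.Bool using (if_then_else_)

φ : ℕ → ℕ
φ n = length (filter (λ m → coprime? m n) (map suc (upTo n)))

∏ : (k : ℕ) → (Fin k → ℕ) → ℕ
∏ zero    f = 1
∏ (suc k) f = f fzero * ∏ k (λ i → f (fsuc i))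

-- M_k = ∏_{i=1}^{k-2} p_i^(2^(k-i-1) - 1); with 0-based index j = i - 1,
-- the factor for j < k - 2 is p_j^(2^(k-j-2) - 1), other factors are 1.
M : (k : ℕ) → (Fin k → ℕ) → ℕ
M k p = ∏ k (λ j → if toℕ j <ᵇ (k ∸ 2)
                     then p j ^ (2 ^ (k ∸ toℕ j ∸ 2) ∸ 1)
                     else 1)

{-# OPTIONS --safe #-}
module Submission where

-- Since n is squarefree, φ(n) ≥ ∏ (pᵢ - 1), which is shown one prime at a time by counting.
-- It then suffices to bound M_k^k by Φ_k^(2^(k-1) - k), Φ_k = ∏ (pᵢ - 1), by induction on the
-- number of primes.  Adding a new largest prime p, with a = p - 1, doubles every exponent of M
-- and adds one, so M_{k+1} ≤ M_k² a^(k-1), while Φ_k ≤ a^k because the primes increase; with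
-- the induction hypothesis this closes the step as soon as k² + k ≤ 2^k, i.e. for k ≥ 5.  The
-- cases k ≤ 5 follow from pᵢ ≤ pⱼ - 1 for i < j and p₁² ≤ (p₁ - 1)(p₃ - 1), as p₃ ≥ p₁ + 3.

open import Defs
open import Algebra.Properties.CommutativeSemigroup using (interchange)
open import Data.Bool using (true; false; T; if_then_else_)
open import Data.Fin using (Fin; toℕ; fromℕ<) renaming (zero to fzero; suc to fsuc; _<_ to _<ᶠ_)
open import Data.Fin.Properties using (toℕ<n; toℕ-fromℕ<; fromℕ<-toℕ)
open import Data.List using (length; filter; applyUpTo)
open import Data.List.Properties using (map-upTo)
open import Data.Nat
  using (ℕ; zero; suc; pred; _+_; _*_; _^_; _∸_; _≤_; _<_; _<ᵇ_; _<?_; _≤?_; z≤n; s≤s; z<s; s<s; NonZero; nonTrivial⇒n>1)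
open import Data.Nat.Properties
open import Data.Nat.Coprimality using (Coprime; coprime?; coprime-+; coprime-divisor; gcd≡1⇒coprime)
open import Data.Nat.Divisibility using (_∣_; _∣?_; divides; ∣-refl; ∣-trans; ∣⇒≤; ∣m+n∣m⇒∣n; ∣m⇒∣m*n)
open import Data.Nat.GCD using (gcd[m,n]∣m; gcd[m,n]∣n)
open import Data.Nat.Primality using (Prime; prime⇒irreducible; prime⇒nonZero; prime⇒nonTrivial; composite[4]; composite⇒¬prime)
open import Data.Nat.Solver using (module +-*-Solver)
open +-*-Solver using (solve; _:+_; _:*_; _:^_; _:=_; con)
open import Data.Product using (_×_; _,_; proj₁)
open import Data.Sum using (_⊎_; inj₁; inj₂)
open import Function using (_∘_)
open import Relation.Binary.PropositionalEquality
open import Relation.Nullary using (Dec; yes; no; ¬_; contradiction)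
open import Relation.Nullary.Decidable using (_×-dec_)
open import Relation.Unary using (Pred; Decidable)

Σ< : ℕ → (ℕ → ℕ) → ℕ
Σ< zero    f = 0
Σ< (suc n) f = f 0 + Σ< n (λ i → f (suc i))

Σ<-cong : ∀ n {f g} → (∀ i → f i ≡ g i) → Σ< n f ≡ Σ< n g
Σ<-cong zero    f≗g = refl
Σ<-cong (suc n) f≗g = cong₂ _+_ (f≗g 0) (Σ<-cong n (f≗g ∘ suc))

Σ<-mono-≤ : ∀ n {f g} → (∀ i → f i ≤ g i) → Σ< n f ≤ Σ< n g
Σ<-mono-≤ zero    f≤g = z≤n
Σ<-mono-≤ (suc n) f≤g = +-mono-≤ (f≤g 0) (Σ<-mono-≤ n (f≤g ∘ suc))

Σ<-distrib-+ : ∀ n f g → Σ< n (λ i → f i + g i) ≡ Σ< n f + Σ< n g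
Σ<-distrib-+ zero    f g = refl
Σ<-distrib-+ (suc n) f g =
  trans (cong (f 0 + g 0 +_) (Σ<-distrib-+ n (f ∘ suc) (g ∘ suc))) (interchange +-commutativeSemigroup (f 0) (g 0) _ _)

Σ<-split : ∀ m n f → Σ< (m + n) f ≡ Σ< m f + Σ< n (λ i → f (m + i))
Σ<-split zero    n f = refl
Σ<-split (suc m) n f = trans (cong (f 0 +_) (Σ<-split m n (f ∘ suc))) (sym (+-assoc (f 0) _ _))

Σ<-snoc : ∀ n f → Σ< (suc n) f ≡ Σ< n f + f n
Σ<-snoc zero    f = +-comm (f 0) 0
Σ<-snoc (suc n) f = trans (cong (f 0 +_) (Σ<-snoc n (f ∘ suc))) (sym (+-assoc (f 0) _ _))

Σ<-vanishing : ∀ n f → (∀ i → i < n → f i ≡ 0) → Σ< n f ≡ 0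
Σ<-vanishing zero    f f≡0 = refl
Σ<-vanishing (suc n) f f≡0 =
  cong₂ _+_ (f≡0 0 z<s) (Σ<-vanishing n (f ∘ suc) (λ i i<n → f≡0 (suc i) (s<s i<n)))

Σ<-periodic : ∀ n f → (∀ i → f i ≤ f (n + i)) → ∀ a → a * Σ< n f ≤ Σ< (a * n) f
Σ<-periodic n f f≤shift zero    = z≤n
Σ<-periodic n f f≤shift (suc a) = begin
  Σ< n f + a * Σ< n f                    ≤⟨ +-monoʳ-≤ (Σ< n f) (Σ<-periodic n f f≤shift a) ⟩
  Σ< n f + Σ< (a * n) f                  ≤⟨ +-monoʳ-≤ (Σ< n f) (Σ<-mono-≤ (a * n) f≤shift) ⟩
  Σ< n f + Σ< (a * n) (λ i → f (n + i))  ≡⟨ Σ<-split n (a * n) f ⟨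
  Σ< (n + a * n) f                       ∎
  where open ≤-Reasoning

Σ<-residue : ∀ r n f → (∀ i → ¬ suc r ∣ suc i → f i ≡ 0) →
             Σ< (n * suc r) f ≡ Σ< n (λ c → f (c * suc r + r))
Σ<-residue r zero    f supp = refl
Σ<-residue r (suc n) f supp = begin
  Σ< (q + n * q) f                              ≡⟨ Σ<-split q (n * q) f ⟩
  Σ< q f + Σ< (n * q) (λ i → f (q + i))         ≡⟨ cong₂ _+_ first-block rest ⟩
  f r + Σ< n (λ c → f (q + c * q + r))          ∎
  where
  open ≡-Reasoning
  q = suc r
  first-block : Σ< q f ≡ f r
  first-block = trans (Σ<-snoc r f)
    (cong (_+ f r) (Σ<-vanishing r f (λ i i<r → supp i (λ q∣ → <⇒≱ (s<s i<r) (∣⇒≤ q∣)))))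
  shifted-supp : ∀ i → ¬ q ∣ suc i → f (q + i) ≡ 0
  shifted-supp i q∤ = supp (q + i) (λ q∣ → q∤ (∣m+n∣m⇒∣n (subst (q ∣_) (sym (+-suc q i)) q∣) ∣-refl))
  rest : Σ< (n * q) (λ i → f (q + i)) ≡ Σ< n (λ c → f (q + c * q + r))
  rest = trans (Σ<-residue r n (λ i → f (q + i)) shifted-supp)
               (Σ<-cong n (λ c → cong f (sym (+-assoc q (c * q) r))))

𝟙[_] : ∀ {a} {A : Set a} → Dec A → ℕ
𝟙[ yes _ ] = 1
𝟙[ no  _ ] = 0

𝟙-mono-≤ : ∀ {a b} {A : Set a} {B : Set b} (A? : Dec A) (B? : Dec B) → (A → B) → 𝟙[ A? ] ≤ 𝟙[ B? ]
𝟙-mono-≤ (no  _) _       _   = z≤n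
𝟙-mono-≤ (yes _) (yes _) _   = ≤-refl
𝟙-mono-≤ (yes a) (no ¬b) A⇒B = contradiction (A⇒B a) ¬b

𝟙-⊎-≤ : ∀ {a b c} {A : Set a} {B : Set b} {C : Set c} (A? : Dec A) (B? : Dec B) (C? : Dec C) →
        (A → B ⊎ C) → 𝟙[ A? ] ≤ 𝟙[ B? ] + 𝟙[ C? ]
𝟙-⊎-≤ (no  _) _       _       _ = z≤n
𝟙-⊎-≤ (yes _) (yes _) _       _ = s≤s z≤n
𝟙-⊎-≤ (yes _) (no  _) (yes _) _ = s≤s z≤n
𝟙-⊎-≤ (yes a) (no ¬b) (no ¬c) A⇒B⊎C with A⇒B⊎C a
... | inj₁ b = contradiction b ¬b
... | inj₂ c = contradiction c ¬c

𝟙-no : ∀ {a} {A : Set a} (A? : Dec A) → ¬ A → 𝟙[ A? ] ≡ 0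
𝟙-no (yes a) ¬a = contradiction a ¬a
𝟙-no (no  _) _  = refl

length-filter-applyUpTo : ∀ {p} {P : Pred ℕ p} (P? : Decidable P) f n →
                          length (filter P? (applyUpTo f n)) ≡ Σ< n (λ i → 𝟙[ P? (f i) ])
length-filter-applyUpTo P? f zero    = refl
length-filter-applyUpTo P? f (suc n) with P? (f 0)
... | yes _ = cong suc (length-filter-applyUpTo P? (f ∘ suc) n)
... | no  _ = length-filter-applyUpTo P? (f ∘ suc) n

φ≡Σ< : ∀ n → φ n ≡ Σ< n (λ i → 𝟙[ coprime? (suc i) n ])
φ≡Σ< n = trans (cong (length ∘ filter (λ m → coprime? m n)) (map-upTo suc n))
               (length-filter-applyUpTo (λ m → coprime? m n) suc n)

-- The totient of a product of distinct primes

prime∤⇒coprime : ∀ {p m} → Prime p → ¬ p ∣ m → Coprime m p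
prime∤⇒coprime {p} {m} pp p∤m with prime⇒irreducible pp (gcd[m,n]∣n m p)
... | inj₁ gcd≡1 = gcd≡1⇒coprime gcd≡1
... | inj₂ gcd≡p = contradiction (subst (_∣ m) gcd≡p (gcd[m,n]∣m m p)) p∤m

coprime⇒coprime-*⊎∣ : ∀ {p m n} → Prime p → Coprime m n → Coprime m (p * n) ⊎ (p ∣ m × Coprime m n)
coprime⇒coprime-*⊎∣ {p} {m} pp m⊥n with p ∣? m
... | yes p∣m = inj₂ (p∣m , m⊥n)
... | no  p∤m = inj₁ λ (d∣m , d∣pn) →
  m⊥n (d∣m , coprime-divisor (prime∤⇒coprime pp (λ p∣d → p∤m (∣-trans p∣d d∣m))) d∣pn)

coprime-*ˡ⇒coprime : ∀ {m o n} → Coprime (m * o) n → Coprime m n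
coprime-*ˡ⇒coprime {o = o} mo⊥n (d∣m , d∣n) = mo⊥n (∣m⇒∣m*n o d∣m , d∣n)

-- Of the q φ(n) integers in [1, qn] coprime to n, those not coprime to qn are multiples c q
-- with c coprime to n, so there are at most φ(n) of them.
q*φ[n]≤φ[q*n]+φ[n] : ∀ r n → Prime (suc r) → suc r * φ n ≤ φ (suc r * n) + φ n
q*φ[n]≤φ[q*n]+φ[n] r n q-prime = begin
  q * φ n                                    ≡⟨ cong (q *_) (φ≡Σ< n) ⟩
  q * Σ< n cop                               ≤⟨ Σ<-periodic n cop cop-shift q ⟩
  Σ< (q * n) cop                             ≤⟨ Σ<-mono-≤ (q * n) cop-split ⟩
  Σ< (q * n) (λ i → cop-q i + mult i)        ≡⟨ Σ<-distrib-+ (q * n) cop-q mult ⟩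
  Σ< (q * n) cop-q + Σ< (q * n) mult         ≡⟨ cong₂ _+_ (φ≡Σ< (q * n)) (cong (λ N → Σ< N mult) (*-comm n q)) ⟨
  φ (q * n) + Σ< (n * q) mult                ≡⟨ cong (φ (q * n) +_) (Σ<-residue r n mult mult-supp) ⟩
  φ (q * n) + Σ< n (λ c → mult (c * q + r))  ≤⟨ +-monoʳ-≤ (φ (q * n)) (Σ<-mono-≤ n mult≤cop) ⟩
  φ (q * n) + Σ< n cop                       ≡⟨ cong (φ (q * n) +_) (φ≡Σ< n) ⟨
  φ (q * n) + φ n                            ∎
  where
  open ≤-Reasoning
  q = suc r
  coprime-n? : ∀ i → Dec (Coprime (suc i) n)
  coprime-n? i = coprime? (suc i) n
  multiple? : ∀ i → Dec (q ∣ suc i × Coprime (suc i) n)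
  multiple? i = q ∣? suc i ×-dec coprime-n? i
  cop cop-q mult : ℕ → ℕ
  cop   i = 𝟙[ coprime-n? i ]
  cop-q i = 𝟙[ coprime? (suc i) (q * n) ]
  mult  i = 𝟙[ multiple? i ]
  cop-shift : ∀ i → cop i ≤ cop (n + i)
  cop-shift i = 𝟙-mono-≤ (coprime-n? i) (coprime-n? (n + i)) (subst (λ m → Coprime m n) (+-suc n i) ∘ coprime-+)
  cop-split : ∀ i → cop i ≤ cop-q i + mult i
  cop-split i = 𝟙-⊎-≤ (coprime-n? i) (coprime? (suc i) (q * n)) (multiple? i) (coprime⇒coprime-*⊎∣ q-prime)
  mult-supp : ∀ i → ¬ q ∣ suc i → mult i ≡ 0
  mult-supp i q∤ = 𝟙-no (multiple? i) (q∤ ∘ proj₁)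
  mult≤cop : ∀ c → mult (c * q + r) ≤ cop c
  mult≤cop c = 𝟙-mono-≤ (multiple? (c * q + r)) (coprime-n? c) λ (_ , cq⊥n) →
    coprime-*ˡ⇒coprime (subst (λ m → Coprime m n) (cong suc (+-comm (c * q) r)) cq⊥n)

[p∸1]*φ[n]≤φ[p*n] : ∀ {p} n → Prime p → (p ∸ 1) * φ n ≤ φ (p * n)
[p∸1]*φ[n]≤φ[p*n] {zero}  n p-prime with () ← prime⇒nonZero p-prime
[p∸1]*φ[n]≤φ[p*n] {suc r} n p-prime = +-cancelˡ-≤ (φ n) (r * φ n) (φ (suc r * n))
  (≤-trans (q*φ[n]≤φ[q*n]+φ[n] r n p-prime) (≤-reflexive (+-comm (φ (suc r * n)) (φ n))))

∏[p∸1]≤φ[∏p] : ∀ k (p : Fin k → ℕ) → (∀ i → Prime (p i)) → ∏ k (λ i → p i ∸ 1) ≤ φ (∏ k p)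
∏[p∸1]≤φ[∏p] zero    p prime = ≤-refl
∏[p∸1]≤φ[∏p] (suc k) p prime = ≤-trans
  (*-monoʳ-≤ (p fzero ∸ 1) (∏[p∸1]≤φ[∏p] k (p ∘ fsuc) (prime ∘ fsuc)))
  ([p∸1]*φ[n]≤φ[p*n] (∏ k (p ∘ fsuc)) (prime fzero))

∏-cong : ∀ k {f g : Fin k → ℕ} → (∀ i → f i ≡ g i) → ∏ k f ≡ ∏ k g
∏-cong zero    f≗g = refl
∏-cong (suc k) f≗g = cong₂ _*_ (f≗g fzero) (∏-cong k (f≗g ∘ fsuc))

∏-mono-≤ : ∀ k {f g : Fin k → ℕ} → (∀ i → f i ≤ g i) → ∏ k f ≤ ∏ k g
∏-mono-≤ zero    f≤g = ≤-refl
∏-mono-≤ (suc k) f≤g = *-mono-≤ (f≤g fzero) (∏-mono-≤ k (f≤g ∘ fsuc))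

∏-distrib-* : ∀ k (f g : Fin k → ℕ) → ∏ k (λ i → f i * g i) ≡ ∏ k f * ∏ k g
∏-distrib-* zero    f g = refl
∏-distrib-* (suc k) f g =
  trans (cong (f fzero * g fzero *_) (∏-distrib-* k (f ∘ fsuc) (g ∘ fsuc))) (interchange *-commutativeSemigroup (f fzero) (g fzero) _ _)

∏-const : ∀ k c → ∏ k (λ _ → c) ≡ c ^ k
∏-const zero    c = refl
∏-const (suc k) c = cong (c *_) (∏-const k c)

∏< : ℕ → (ℕ → ℕ) → ℕ
∏< n f = ∏ n (λ i → f (toℕ i))

∏<-snoc : ∀ n f → ∏< (suc n) f ≡ ∏< n f * f n
∏<-snoc zero    f = *-comm (f 0) 1
∏<-snoc (suc n) f = trans (cong (f 0 *_) (∏<-snoc n (f ∘ suc))) (sym (*-assoc (f 0) _ _))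

^-distribʳ-* : ∀ m n o → (m * n) ^ o ≡ m ^ o * n ^ o
^-distribʳ-* m n zero    = refl
^-distribʳ-* m n (suc o) = trans (cong (m * n *_) (^-distribʳ-* m n o)) (interchange *-commutativeSemigroup m n _ _)

^-cancelʳ-≤ : ∀ {m n} o .{{_ : NonZero o}} → m ^ o ≤ n ^ o → m ≤ n
^-cancelʳ-≤ {m} {n} o mᵒ≤nᵒ with m ≤? n
... | yes m≤n = m≤n
... | no  m≰n = contradiction mᵒ≤nᵒ (<⇒≱ (^-monoˡ-< o (≰⇒> m≰n)))

prime⇒>1 : ∀ {p} → Prime p → 1 < p
prime⇒>1 {p} pp = nonTrivial⇒n>1 p {{prime⇒nonTrivial pp}}

2∣n⊎2∣1+n : ∀ n → 2 ∣ n ⊎ 2 ∣ suc n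
2∣n⊎2∣1+n zero          = inj₁ (divides 0 refl)
2∣n⊎2∣1+n (suc zero)    = inj₂ (divides 1 refl)
2∣n⊎2∣1+n (suc (suc n)) with 2∣n⊎2∣1+n n
... | inj₁ (divides c n≡c*2) = inj₁ (divides (suc c) (cong (2 +_) n≡c*2))
... | inj₂ (divides c n≡c*2) = inj₂ (divides (suc c) (cong (2 +_) n≡c*2))

even-prime : ∀ {p} → Prime p → 2 ∣ p → p ≡ 2
even-prime pp 2∣p with prime⇒irreducible pp 2∣p
... | inj₁ ()
... | inj₂ 2≡p = sym 2≡p

consecutive-primes : ∀ {p} → Prime p → Prime (suc p) → p ≡ 2
consecutive-primes {p} pp psp with 2∣n⊎2∣1+n p
... | inj₁ 2∣p  = even-prime pp 2∣p
... | inj₂ 2∣1+p = contradiction (cong pred (even-prime psp 2∣1+p)) (>⇒≢ (prime⇒>1 pp))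

prime-gap : ∀ {x y z} → Prime x → Prime y → Prime z → x < y → y < z → 3 + x ≤ z
prime-gap px py pz x<y y<z with m≤n⇒m<n∨m≡n x<y
... | inj₁ 1+x<y = ≤-trans (s≤s 1+x<y) y<z
... | inj₂ refl with consecutive-primes px py
... | refl = ≤∧≢⇒< y<z λ 4≡z → composite⇒¬prime composite[4] (subst Prime (sym 4≡z) pz)

square-≤-pred*pred : ∀ {x z} → 1 < x → 3 + x ≤ z → x * x ≤ (x ∸ 1) * (z ∸ 1)
square-≤-pred*pred {x@(suc (suc w))} {z} (s≤s (s≤s z≤n)) 3+x≤z = begin
  x * x                ≤⟨ m≤m+n (x * x) w ⟩
  x * x + w            ≡⟨ solve 1 (λ w → (con 2 :+ w) :* (con 2 :+ w) :+ w := (con 1 :+ w) :* (con 4 :+ w)) refl w ⟩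
  (1 + w) * (4 + w)    ≤⟨ *-monoʳ-≤ (suc w) (∸-monoˡ-≤ 1 3+x≤z) ⟩
  (1 + w) * (z ∸ 1)    ∎
  where open ≤-Reasoning

record PrimeChain (k : ℕ) (q : ℕ → ℕ) : Set where
  field
    prime      : ∀ {i} → i < k → Prime (q i)
    increasing : ∀ {i j} → i < j → j < k → q i < q j

  ≤-pred-later : ∀ {i j} → i < j → j < k → q i ≤ q j ∸ 1
  ≤-pred-later i<j j<k = <⇒≤pred (increasing i<j j<k)

  pred-mono-later : ∀ {i j} → i < j → j < k → q i ∸ 1 ≤ q j ∸ 1
  pred-mono-later i<j j<k = pred-mono-≤ (<⇒≤ (increasing i<j j<k))

  square-≤ : ∀ j → 2 + j < k → q j * q j ≤ (q j ∸ 1) * (q (2 + j) ∸ 1)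
  square-≤ j 2+j<k = square-≤-pred*pred (prime⇒>1 (prime j<k))
    (prime-gap (prime j<k) (prime 1+j<k) (prime 2+j<k) (increasing (n<1+n j) 1+j<k) (increasing (n<1+n (1 + j)) 2+j<k))
    where
    1+j<k = <-trans (n<1+n (1 + j)) 2+j<k
    j<k   = <-trans (n<1+n j) 1+j<k

shorten : ∀ {k q} → PrimeChain (suc k) q → PrimeChain k q
shorten c = record
  { prime      = λ i<k → prime (m<n⇒m<1+n i<k)
  ; increasing = λ i<j j<k → increasing i<j (m<n⇒m<1+n j<k)
  }
  where open PrimeChain c

-- The bound on M for ℕ-indexed chains

-- Vanishes for j ≥ k - 2, which makes the guard in M redundant.
weight : ℕ → ℕ → ℕ
weight k j = 2 ^ (k ∸ j ∸ 2) ∸ 1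

Mℕ : ℕ → (ℕ → ℕ) → ℕ
Mℕ k q = ∏< k (λ j → q j ^ weight k j)

Φℕ : ℕ → (ℕ → ℕ) → ℕ
Φℕ k q = ∏< k (λ j → q j ∸ 1)

excess : ℕ → ℕ
excess k = 2 ^ (k ∸ 1) ∸ k

<-lit : ∀ {m n} → {T (m <ᵇ n)} → m < n
<-lit {m} {n} {m<ᵇn} = <ᵇ⇒< m n m<ᵇn

module _ {q : ℕ → ℕ} where
  open ≤-Reasoning

  -- The solver is fed the unfolded products, in which the factors of weight 0 have already become 1.
  Mℕ-3 : Mℕ 3 q ≡ q 0
  Mℕ-3 = solve 1 (λ x → x :* con 1 :* con 1 := x) refl (q 0)

  Mℕ-4 : Mℕ 4 q ≡ q 0 ^ 3 * q 1
  Mℕ-4 = solve 2 (λ x y → x :^ 3 :* (y :^ 1 :* con 1) := x :^ 3 :* y) refl (q 0) (q 1)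

  Mℕ-5 : Mℕ 5 q ≡ q 0 ^ 7 * q 1 ^ 3 * q 2
  Mℕ-5 = solve 3 (λ x y z → x :^ 7 :* (y :^ 3 :* (z :^ 1 :* con 1)) := x :^ 7 :* y :^ 3 :* z) refl (q 0) (q 1) (q 2)

  Mℕ-bound₃ : PrimeChain 3 q → Mℕ 3 q ^ 3 ≤ Φℕ 3 q ^ excess 3
  Mℕ-bound₃ c = begin
    Mℕ 3 q ^ 3               ≡⟨ cong (_^ 3) Mℕ-3 ⟩
    q 0 ^ 3                  ≡⟨ solve 1 (λ x → x :^ 3 := x :* x :* x) refl (q 0) ⟩
    q 0 * q 0 * q 0          ≤⟨ *-mono-≤ (square-≤ 0 <-lit) (≤-pred-later <-lit <-lit) ⟩
    (A * C) * B              ≡⟨ solve 3 (λ a b c → a :* c :* b := (a :* (b :* (c :* con 1))) :^ 1) refl A B C ⟩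
    Φℕ 3 q ^ excess 3        ∎
    where
    open PrimeChain c
    A = q 0 ∸ 1
    B = q 1 ∸ 1
    C = q 2 ∸ 1

  Mℕ-bound₄ : PrimeChain 4 q → Mℕ 4 q ^ 4 ≤ Φℕ 4 q ^ excess 4
  Mℕ-bound₄ c = ^-monoˡ-≤ 4 (begin
    Mℕ 4 q                   ≡⟨ Mℕ-4 ⟩
    q 0 ^ 3 * q 1            ≡⟨ solve 2 (λ x y → x :^ 3 :* y := x :* x :* x :* y) refl (q 0) (q 1) ⟩
    q 0 * q 0 * q 0 * q 1    ≤⟨ *-mono-≤ (*-mono-≤ (square-≤ 0 <-lit) (≤-pred-later <-lit <-lit)) (≤-pred-later <-lit <-lit) ⟩
    (A * C) * B * D          ≡⟨ solve 4 (λ a b c d → a :* c :* b :* d := a :* (b :* (c :* (d :* con 1)))) refl A B C D ⟩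
    Φℕ 4 q                   ∎)
    where
    open PrimeChain c
    A = q 0 ∸ 1
    B = q 1 ∸ 1
    C = q 2 ∸ 1
    D = q 3 ∸ 1

  Mℕ-bound₅ : PrimeChain 5 q → Mℕ 5 q ^ 5 ≤ Φℕ 5 q ^ excess 5
  Mℕ-bound₅ c = begin
    Mℕ 5 q ^ 5
      ≡⟨ cong (_^ 5) Mℕ-5 ⟩
    (x ^ 7 * y ^ 3 * z) ^ 5
      ≡⟨ solve 3 (λ x y z → (x :^ 7 :* y :^ 3 :* z) :^ 5
                            := (x :* x) :^ 11 :* x :^ 11 :* x :^ 2 :* y :^ 9 :* y :^ 6 :* z :^ 5) refl x y z ⟩
    (x * x) ^ 11 * x ^ 11 * x ^ 2 * y ^ 9 * y ^ 6 * z ^ 5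
      ≤⟨ *-mono-≤ (*-mono-≤ (*-mono-≤ (*-mono-≤ (*-mono-≤
           (^-monoˡ-≤ 11 (square-≤ 0 <-lit))
           (^-monoˡ-≤ 11 (≤-pred-later <-lit <-lit)))
           (^-monoˡ-≤ 2 (≤-pred-later <-lit <-lit)))
           (^-monoˡ-≤ 9 (≤-pred-later <-lit <-lit)))
           (^-monoˡ-≤ 6 (≤-pred-later <-lit <-lit)))
           (^-monoˡ-≤ 5 (≤-pred-later <-lit <-lit)) ⟩
    (A * C) ^ 11 * B ^ 11 * D ^ 2 * D ^ 9 * G ^ 6 * G ^ 5
      ≡⟨ solve 5 (λ a b c d g → (a :* c) :^ 11 :* b :^ 11 :* d :^ 2 :* d :^ 9 :* g :^ 6 :* g :^ 5
                                := (a :* (b :* (c :* (d :* (g :* con 1))))) :^ 11) refl A B C D G ⟩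
    Φℕ 5 q ^ excess 5
      ∎
    where
    open PrimeChain c
    x = q 0
    y = q 1
    z = q 2
    A = q 0 ∸ 1
    B = q 1 ∸ 1
    C = q 2 ∸ 1
    D = q 3 ∸ 1
    G = q 4 ∸ 1

n<2^n : ∀ n → n < 2 ^ n
n<2^n zero    = z<s
n<2^n (suc n) = +-mono-≤ (m^n>0 2 n) (≤-trans (n<2^n n) (m≤m+n (2 ^ n) 0))

2^suc∸1 : ∀ d → 2 ^ suc d ∸ 1 ≡ (2 ^ d ∸ 1) + (2 ^ d ∸ 1) + 1
2^suc∸1 d with 2 ^ d | m^n>0 2 d
... | suc e | _ = solve 1 (λ e → e :+ (con 1 :+ e :+ con 0) := e :+ e :+ con 1) refl e

weight-∸-+ : ∀ k j → weight k j ≡ 2 ^ (k ∸ (2 + j)) ∸ 1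
weight-∸-+ k j = cong (λ e → 2 ^ e ∸ 1) (trans (∸-+-assoc k j 2) (cong (k ∸_) (+-comm j 2)))

weight-vanishes : ∀ {k j} → k ∸ 2 ≤ j → weight k j ≡ 0
weight-vanishes {k} {j} k∸2≤j =
  trans (weight-∸-+ k j) (cong (λ e → 2 ^ e ∸ 1) (trans (sym (∸-+-assoc k 2 j)) (m≤n⇒m∸n≡0 k∸2≤j)))

weight-suc : ∀ {k j} → 2 + j ≤ k → weight (suc k) j ≡ weight k j + weight k j + 1
weight-suc {k} {j} 2+j≤k = begin
  weight (suc k) j             ≡⟨ weight-∸-+ (suc k) j ⟩
  2 ^ (suc k ∸ (2 + j)) ∸ 1    ≡⟨ cong (λ e → 2 ^ e ∸ 1) (+-∸-assoc 1 2+j≤k) ⟩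
  2 ^ suc d ∸ 1                ≡⟨ 2^suc∸1 d ⟩
  w + w + 1                    ≡⟨ cong (λ v → v + v + 1) (weight-∸-+ k j) ⟨
  weight k j + weight k j + 1  ∎
  where
  open ≡-Reasoning
  d = k ∸ (2 + j)
  w = 2 ^ d ∸ 1

∏<-trailing-ones : ∀ d n f → (∀ i → n ≤ i → f i ≡ 1) → ∏< (d + n) f ≡ ∏< n f
∏<-trailing-ones zero    n f ones = refl
∏<-trailing-ones (suc d) n f ones = begin
  ∏< (suc (d + n)) f        ≡⟨ ∏<-snoc (d + n) f ⟩
  ∏< (d + n) f * f (d + n)  ≡⟨ cong₂ _*_ (∏<-trailing-ones d n f ones) (ones (d + n) (m≤n+m n d)) ⟩
  ∏< n f * 1                ≡⟨ *-identityʳ (∏< n f) ⟩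
  ∏< n f                    ∎
  where open ≡-Reasoning

Mℕ-trim : ∀ d m q → d ≤ 2 → Mℕ (d + m) q ≡ ∏< m (λ j → q j ^ weight (d + m) j)
Mℕ-trim d m q d≤2 = ∏<-trailing-ones d m _ λ i m≤i →
  cong (q i ^_) (weight-vanishes (≤-trans (∸-monoˡ-≤ 2 (+-monoˡ-≤ m d≤2)) m≤i))

Mℕ-suc-≤ : ∀ {m q} → PrimeChain (2 + m) q →
           Mℕ (2 + m) q ≤ Mℕ (1 + m) q * Mℕ (1 + m) q * (q (1 + m) ∸ 1) ^ m
Mℕ-suc-≤ {m} {q} c = begin
  Mℕ (2 + m) q                           ≡⟨ Mℕ-trim 2 m q ≤-refl ⟩
  ∏< m (λ j → q j ^ weight (2 + m) j)    ≤⟨ ∏-mono-≤ m (λ j → factor-≤ (toℕ j) (toℕ<n j)) ⟩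
  ∏< m (λ j → f j * f j * a)             ≡⟨ ∏-distrib-* m _ _ ⟩
  ∏< m (λ j → f j * f j) * ∏< m (λ _ → a) ≡⟨ cong₂ _*_ (∏-distrib-* m _ _) (∏-const m a) ⟩
  ∏< m f * ∏< m f * a ^ m                ≡⟨ cong (λ y → y * y * a ^ m) (Mℕ-trim 1 m q (s≤s z≤n)) ⟨
  Mℕ (1 + m) q * Mℕ (1 + m) q * a ^ m    ∎
  where
  open ≤-Reasoning
  open PrimeChain c
  a = q (1 + m) ∸ 1
  f : ℕ → ℕ
  f j = q j ^ weight (1 + m) j
  factor-≤ : ∀ j → j < m → q j ^ weight (2 + m) j ≤ f j * f j * a
  factor-≤ j j<m = begin
    q j ^ weight (2 + m) j                  ≡⟨ cong (q j ^_) (weight-suc (s≤s j<m)) ⟩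
    q j ^ (w + w + 1)                       ≡⟨ ^-distribˡ-+-* (q j) (w + w) 1 ⟩
    q j ^ (w + w) * q j ^ 1                 ≡⟨ cong₂ _*_ (^-distribˡ-+-* (q j) w w) (*-identityʳ (q j)) ⟩
    f j * f j * q j                         ≤⟨ *-monoʳ-≤ (f j * f j) (≤-pred-later (m<n⇒m<1+n j<m) ≤-refl) ⟩
    f j * f j * a                           ∎
    where w = weight (1 + m) j

Φℕ-snoc : ∀ k q → Φℕ (suc k) q ≡ Φℕ k q * (q k ∸ 1)
Φℕ-snoc k q = ∏<-snoc k (λ j → q j ∸ 1)

Φℕ-≤-pow : ∀ {k q} → PrimeChain (suc k) q → Φℕ k q ≤ (q k ∸ 1) ^ k
Φℕ-≤-pow {k} {q} c = ≤-trans (∏-mono-≤ k (λ i → pred-mono-later (toℕ<n i) ≤-refl)) (≤-reflexive (∏-const k _))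
  where open PrimeChain c

excess-suc : ∀ m → excess (2 + m) ≡ 2 * excess (1 + m) + m
excess-suc m = begin
  2 * 2 ^ m ∸ (2 + m)               ≡⟨ cong (λ x → 2 * x ∸ (2 + m)) (m∸n+n≡m (n<2^n m)) ⟨
  2 * (t + suc m) ∸ (2 + m)          ≡⟨ cong (_∸ (2 + m)) (solve 2 (λ t m → con 2 :* (t :+ (con 1 :+ m)) := (con 2 :* t :+ m) :+ (con 2 :+ m)) refl t m) ⟩
  (2 * t + m) + (2 + m) ∸ (2 + m)   ≡⟨ m+n∸n≡m (2 * t + m) (2 + m) ⟩
  2 * t + m                         ∎
  where
  open ≡-Reasoning
  t = 2 ^ m ∸ suc m

n*n+n≤2^n : ∀ {n} → 5 ≤ n → n * n + n ≤ 2 ^ n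
n*n+n≤2^n 5≤n with m≤n⇒∃[o]m+o≡n 5≤n
... | t , refl = from-5 t
  where
  from-5 : ∀ t → (5 + t) * (5 + t) + (5 + t) ≤ 2 ^ (5 + t)
  from-5 zero    = m≤m+n 30 2
  from-5 (suc t) = begin
    (6 + t) * (6 + t) + (6 + t)                           ≤⟨ m≤m+n _ (t * t + 9 * t + 18) ⟩
    (6 + t) * (6 + t) + (6 + t) + (t * t + 9 * t + 18)    ≡⟨ solve 1 (λ t →
        (con 6 :+ t) :* (con 6 :+ t) :+ (con 6 :+ t) :+ (t :* t :+ con 9 :* t :+ con 18)
        := con 2 :* ((con 5 :+ t) :* (con 5 :+ t) :+ (con 5 :+ t))) refl t ⟩
    2 * ((5 + t) * (5 + t) + (5 + t))                     ≤⟨ *-monoʳ-≤ 2 (from-5 t) ⟩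
    2 * 2 ^ (5 + t)                                       ∎
    where open ≤-Reasoning

excess-lower : ∀ {m} → 4 ≤ m → suc m * m ≤ 2 * excess (suc m)
excess-lower {m} 4≤m = begin
  suc m * m               ≤⟨ m+n≤o⇒m≤o∸n (suc m * m) (≤-trans (≤-reflexive rearrange) (n*n+n≤2^n (s≤s 4≤m))) ⟩
  2 * 2 ^ m ∸ 2 * suc m   ≡⟨ *-distribˡ-∸ 2 (2 ^ m) (suc m) ⟨
  2 * (2 ^ m ∸ suc m)     ∎
  where
  open ≤-Reasoning
  rearrange : suc m * m + 2 * suc m ≡ suc m * suc m + suc m
  rearrange = solve 1 (λ m → (con 1 :+ m) :* m :+ con 2 :* (con 1 :+ m)
                           := (con 1 :+ m) :* (con 1 :+ m) :+ (con 1 :+ m)) refl m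

^-expand : ∀ y b m s k → ((y * y * b ^ m) ^ s) ^ k ≡ (y ^ k) ^ (2 * s) * b ^ (m * (s * k))
^-expand y b m s k = begin
  ((y * y * b ^ m) ^ s) ^ k          ≡⟨ ^-*-assoc (y * y * b ^ m) s k ⟩
  (y * y * b ^ m) ^ n                ≡⟨ ^-distribʳ-* (y * y) (b ^ m) n ⟩
  (y * y) ^ n * (b ^ m) ^ n          ≡⟨ cong₂ _*_ (^-distribʳ-* y y n) (^-*-assoc b m n) ⟩
  y ^ n * y ^ n * b ^ (m * n)        ≡⟨ cong (_* b ^ (m * n)) (^-distribˡ-+-* y n n) ⟨
  y ^ (n + n) * b ^ (m * n)          ≡⟨ cong (λ e → y ^ e * b ^ (m * n))
                                          (solve 2 (λ s k → s :* k :+ s :* k := k :* (con 2 :* s)) refl s k) ⟩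
  y ^ (k * (2 * s)) * b ^ (m * n)    ≡⟨ cong (_* b ^ (m * n)) (^-*-assoc y k (2 * s)) ⟨
  (y ^ k) ^ (2 * s) * b ^ (m * n)    ∎
  where
  open ≡-Reasoning
  n = s * k

^-collect : ∀ x a k D e E → k * D + e ≡ k * E → x ^ (k * E) * (a ^ k) ^ D * a ^ e ≡ ((x * a) ^ E) ^ k
^-collect x a k D e E kD+e≡kE = begin
  x ^ (k * E) * (a ^ k) ^ D * a ^ e     ≡⟨ *-assoc (x ^ (k * E)) _ _ ⟩
  x ^ (k * E) * ((a ^ k) ^ D * a ^ e)   ≡⟨ cong (λ y → x ^ (k * E) * (y * a ^ e)) (^-*-assoc a k D) ⟩
  x ^ (k * E) * (a ^ (k * D) * a ^ e)   ≡⟨ cong (x ^ (k * E) *_) (^-distribˡ-+-* a (k * D) e) ⟨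
  x ^ (k * E) * a ^ (k * D + e)         ≡⟨ cong (λ f → x ^ (k * E) * a ^ f) kD+e≡kE ⟩
  x ^ (k * E) * a ^ (k * E)             ≡⟨ ^-distribʳ-* x a (k * E) ⟨
  (x * a) ^ (k * E)                     ≡⟨ cong ((x * a) ^_) (*-comm k E) ⟩
  (x * a) ^ (E * k)                     ≡⟨ ^-*-assoc (x * a) E k ⟨
  ((x * a) ^ E) ^ k                     ∎
  where open ≡-Reasoning

module _ (m D E : ℕ) (2E≡ : 2 * E ≡ suc m * m + D) where
  open ≡-Reasoning

  step-exponent-Φ : E * (2 * (2 + m)) ≡ suc m * (2 * E + m) + D
  step-exponent-Φ = begin
    E * (2 * (2 + m))              ≡⟨ solve 2 (λ E m → E :* (con 2 :* (con 2 :+ m)) := con 2 :* E :* (con 2 :+ m)) refl E m ⟩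
    2 * E * (2 + m)                ≡⟨ cong (_* (2 + m)) 2E≡ ⟩
    (suc m * m + D) * (2 + m)      ≡⟨ solve 2 (λ m D → ((con 1 :+ m) :* m :+ D) :* (con 2 :+ m)
                                             := (con 1 :+ m) :* ((con 1 :+ m) :* m :+ D :+ m) :+ D) refl m D ⟩
    suc m * (suc m * m + D + m) + D  ≡⟨ cong (λ e → suc m * (e + m) + D) 2E≡ ⟨
    suc m * (2 * E + m) + D        ∎

  step-exponent-a : suc m * D + m * ((2 + m) * suc m) ≡ suc m * (2 * E + m)
  step-exponent-a = begin
    suc m * D + m * ((2 + m) * suc m)  ≡⟨ solve 2 (λ m D → (con 1 :+ m) :* D :+ m :* ((con 2 :+ m) :* (con 1 :+ m))
                                                 := (con 1 :+ m) :* ((con 1 :+ m) :* m :+ D :+ m)) refl m D ⟩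
    suc m * (suc m * m + D + m)        ≡⟨ cong (λ e → suc m * (e + m)) 2E≡ ⟨
    suc m * (2 * E + m)                ∎

-- Compare k-th powers, k = m + 1, so that Yᵏ ≤ Φᴱ applies; the surplus Φ^D is bounded by a^(k D).
power-step : ∀ m D {X Y Φ a E} →
             X ≤ Y * Y * a ^ m → Φ ≤ a ^ suc m → Y ^ suc m ≤ Φ ^ E → 2 * E ≡ suc m * m + D →
             X ^ (2 + m) ≤ (Φ * a) ^ (2 * E + m)
power-step m D {X} {Y} {Φ} {a} {E} X≤ Φ≤ Yᵏ≤ 2E≡ = ^-cancelʳ-≤ k (begin
  (X ^ (2 + m)) ^ k                       ≤⟨ ^-monoˡ-≤ k (^-monoˡ-≤ (2 + m) X≤) ⟩
  ((Y * Y * a ^ m) ^ (2 + m)) ^ k         ≡⟨ ^-expand Y a m (2 + m) k ⟩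
  (Y ^ k) ^ (2 * (2 + m)) * a ^ e         ≤⟨ *-monoˡ-≤ (a ^ e) (^-monoˡ-≤ (2 * (2 + m)) Yᵏ≤) ⟩
  (Φ ^ E) ^ (2 * (2 + m)) * a ^ e         ≡⟨ cong (_* a ^ e) Φ-split ⟩
  Φ ^ (k * E′) * Φ ^ D * a ^ e            ≤⟨ *-monoˡ-≤ (a ^ e) (*-monoʳ-≤ (Φ ^ (k * E′)) (^-monoˡ-≤ D Φ≤)) ⟩
  Φ ^ (k * E′) * (a ^ k) ^ D * a ^ e      ≡⟨ ^-collect Φ a k D e E′ (step-exponent-a m D E 2E≡) ⟩
  ((Φ * a) ^ E′) ^ k                      ∎)
  where
  open ≤-Reasoning
  k  = suc m
  e  = m * ((2 + m) * k)
  E′ = 2 * E + m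
  Φ-split : (Φ ^ E) ^ (2 * (2 + m)) ≡ Φ ^ (k * E′) * Φ ^ D
  Φ-split = trans (^-*-assoc Φ E (2 * (2 + m)))
                  (trans (cong (Φ ^_) (step-exponent-Φ m D E 2E≡)) (^-distribˡ-+-* Φ (k * E′) D))

Mℕ-bound-step : ∀ {m q} → 4 ≤ m → PrimeChain (2 + m) q →
                Mℕ (1 + m) q ^ (1 + m) ≤ Φℕ (1 + m) q ^ excess (1 + m) →
                Mℕ (2 + m) q ^ (2 + m) ≤ Φℕ (2 + m) q ^ excess (2 + m)
Mℕ-bound-step {m} {q} 4≤m c ih =
  subst₂ (λ Φ e → Mℕ (2 + m) q ^ (2 + m) ≤ Φ ^ e) (sym (Φℕ-snoc (1 + m) q)) (sym (excess-suc m))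
    (power-step m D {Y = Mℕ (1 + m) q} {E = E} (Mℕ-suc-≤ c) (Φℕ-≤-pow c) ih (sym (m+[n∸m]≡n (excess-lower 4≤m))))
  where
  E = excess (1 + m)
  D = 2 * E ∸ suc m * m

-- The step needs k² + k ≤ 2^k, which fails for k < 5.
Mℕ-bound : ∀ k {q} → PrimeChain k q → Mℕ k q ^ k ≤ Φℕ k q ^ excess k
Mℕ-bound 0 _ = ≤-refl
Mℕ-bound 1 _ = ≤-refl
Mℕ-bound 2 _ = ≤-refl
Mℕ-bound 3 c = Mℕ-bound₃ c
Mℕ-bound 4 c = Mℕ-bound₄ c
Mℕ-bound 5 c = Mℕ-bound₅ c
Mℕ-bound (suc (suc m@(suc (suc (suc (suc _)))))) c = Mℕ-bound-step (m≤m+n 4 _) c (Mℕ-bound (suc m) (shorten c))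

extend : ∀ {k} → (Fin k → ℕ) → ℕ → ℕ
extend {k} p i with i <? k
... | yes i<k = p (fromℕ< i<k)
... | no  _   = 0

extend-< : ∀ {k} (p : Fin k → ℕ) {i} (i<k : i < k) → extend p i ≡ p (fromℕ< i<k)
extend-< {k} p {i} i<k with i <? k
... | yes _   = refl
... | no  i≮k = contradiction i<k i≮k

extend-toℕ : ∀ {k} (p : Fin k → ℕ) j → extend p (toℕ j) ≡ p j
extend-toℕ p j = trans (extend-< p (toℕ<n j)) (cong p (fromℕ<-toℕ j (toℕ<n j)))

extend-chain : ∀ {k} {p : Fin k → ℕ} → (∀ i → Prime (p i)) → (∀ i j → i <ᶠ j → p i < p j) →
               PrimeChain k (extend p)
extend-chain {p = p} prime increasing = record
  { prime      = λ i<k → subst Prime (sym (extend-< p i<k)) (prime _)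
  ; increasing = λ i<j j<k →
      subst₂ _<_ (sym (extend-< p (<-trans i<j j<k))) (sym (extend-< p j<k))
        (increasing _ _ (subst₂ _<_ (sym (toℕ-fromℕ< (<-trans i<j j<k))) (sym (toℕ-fromℕ< j<k)) i<j))
  }

weight-guard : ∀ k j x → (if j <ᵇ k ∸ 2 then x ^ weight k j else 1) ≡ x ^ weight k j
weight-guard k j x with j <ᵇ k ∸ 2 in guard
... | true  = refl
... | false = cong (x ^_) (sym (weight-vanishes {k} {j} (≮⇒≥ λ j<k∸2 → subst T guard (<⇒<ᵇ j<k∸2))))

M≡Mℕ : ∀ k (p : Fin k → ℕ) → M k p ≡ Mℕ k (extend p)
M≡Mℕ k p = ∏-cong k λ j →
  trans (weight-guard k (toℕ j) (p j)) (cong (_^ weight k (toℕ j)) (sym (extend-toℕ p j)))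

∏-pred≡Φℕ : ∀ k (p : Fin k → ℕ) → ∏ k (λ i → p i ∸ 1) ≡ Φℕ k (extend p)
∏-pred≡Φℕ k p = ∏-cong k λ j → cong (_∸ 1) (sym (extend-toℕ p j))

theorem4 : (k : ℕ) → 1 ≤ k → (p : Fin k → ℕ)
         → (∀ i → Prime (p i))
         → (∀ i j → i <ᶠ j → p i < p j)
         → M k p ^ k ≤ φ (∏ k p) ^ (2 ^ (k ∸ 1) ∸ k)
theorem4 k _ p prime increasing = begin
  M k p ^ k                        ≡⟨ cong (_^ k) (M≡Mℕ k p) ⟩
  Mℕ k (extend p) ^ k              ≤⟨ Mℕ-bound k (extend-chain prime increasing) ⟩
  Φℕ k (extend p) ^ excess k       ≡⟨ cong (_^ excess k) (∏-pred≡Φℕ k p) ⟨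
  ∏ k (λ i → p i ∸ 1) ^ excess k   ≤⟨ ^-monoˡ-≤ (excess k) (∏[p∸1]≤φ[∏p] k p prime) ⟩
  φ (∏ k p) ^ excess k             ∎
  where open ≤-Reasoning
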